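{- Let $G$ be a finite simple graph of order $n$ such that for every vertex $v\in V(G)$, the subgraph $G[N(v)]$ of $G$ induced by the neighborhood of $v$ is isomorphic to $C_3+K_1$. Then $n\equiv 0 \pmod 4$.
   Context: $N(v)$ denotes the set of neighbors of $v$ and $G[S]$ the subgraph induced by $S$. $C_3+K_1$ denotes the disjoint union of a triangle (cycle on $3$ vertices) and a single isolated vertex. Isomorphic graphs are identified. -}

module Defs where

open import Data.Nat using (ℕ)
open import Data.Fin using (Fin; zero; suc)
open import Data.Product using (Σ; _×_; _,_; ∃)
open import Data.Empty using (⊥)
open import Data.Unit using (⊤)
open import Relation.Nullary using (¬_; Dec)
open import Relation.Binary.PropositionalEquality using (_≡_)
open import Function.Bundles using (_⇔_)
open import Level using (0ℓ)

record SimpleGraph (n : ℕ) : Set₁ where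
  field
    Adj     : Fin n → Fin n → Set
    adj?    : ∀ u v → Dec (Adj u v)
    sym     : ∀ {u v} → Adj u v → Adj v u
    irrefl  : ∀ {v} → ¬ Adj v v

C3+K1-Adj : Fin 4 → Fin 4 → Set
C3+K1-Adj zero zero = ⊥
C3+K1-Adj zero (suc zero) = ⊤
C3+K1-Adj zero (suc (suc zero)) = ⊤
C3+K1-Adj (suc zero) zero = ⊤
C3+K1-Adj (suc zero) (suc (suc zero)) = ⊤
C3+K1-Adj (suc (suc zero)) zero = ⊤
C3+K1-Adj (suc (suc zero)) (suc zero) = ⊤
C3+K1-Adj _ _ = ⊥

NbhdIsoC3+K1 : ∀ {n} → SimpleGraph n → Fin n → Set
NbhdIsoC3+K1 {n} G v =
  Σ (Fin 4 → Fin n) λ f →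
      (∀ i → Adj v (f i))
    × (∀ i j → f i ≡ f j → i ≡ j)
    × (∀ w → Adj v w → ∃ λ i → f i ≡ w)
    × (∀ i j → Adj (f i) (f j) ⇔ C3+K1-Adj i j)
  where open SimpleGraph G

module Submission where

-- Call x and y linked when x = y or the edge xy lies on a triangle.  In N(y) the
-- vertices on triangles through y are exactly the C₃ part, hence pairwise adjacent;
-- so linkedness is transitive and the class of v is v together with that triangle,
-- a K₄.  The vertex set is thus partitioned into classes of size 4.

open import Defs
open import Data.Nat using (ℕ; suc; _%_; _+_; _<_)
open import Data.Nat.Properties using (+-suc)
open import Data.Nat.Divisibility using (_∣_; _∣0; ∣-refl; ∣m∣n⇒∣m+n; n∣m⇒m%n≡0)
open import Data.Nat.Induction using (<-wellFounded)
open import Induction.WellFounded using (Acc; acc)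
open import Data.Fin using (Fin; zero; suc)
open import Data.Fin.Properties using (any?) renaming (_≟_ to _≟ᶠ_)
open import Data.List using (List; []; _∷_; length; filter; allFin)
open import Data.List.Properties using (filter-notAll; filter-reject; length-tabulate)
open import Data.List.Membership.Propositional using (_∈_)
open import Data.List.Membership.Propositional.Properties using (∈-filter⁺; ∈-filter⁻; ∈-allFin)
open import Data.List.Membership.Propositional.Properties.WithK using (unique∧set⇒bag)
open import Data.List.Relation.Unary.Any using (here; there)
open import Data.List.Relation.Unary.AllPairs using ([]; _∷_)
open import Data.List.Relation.Unary.All using ([]; _∷_)
open import Data.List.Relation.Unary.Unique.Propositional using (Unique)
open import Data.List.Relation.Unary.Unique.Propositional.Properties using (filter⁺; allFin⁺)
open import Data.List.Relation.Binary.BagAndSetEquality using (_∼[_]_; set; ∼bag⇒↭)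
open import Data.List.Relation.Binary.Permutation.Propositional.Properties using (↭-length)
open import Data.Product using (_×_; _,_; ∃; proj₁; proj₂)
open import Data.Sum using (_⊎_; inj₁; inj₂)
open import Data.Empty using (⊥-elim)
open import Data.Unit using (tt)
open import Function using (_∘_; id)
open import Function.Bundles using (_⇔_; mk⇔; Equivalence)
open import Relation.Nullary using (Dec; yes; no)
open import Relation.Nullary.Decidable using (_×-dec_; _⊎-dec_)
open import Relation.Unary using (Pred; Decidable; _⊆_; ∁)
open import Relation.Unary.Properties using (∁?)
open import Relation.Binary using (Rel; IsDecEquivalence)
open import Relation.Binary.PropositionalEquality using (_≡_; _≢_; refl; sym; trans; cong; subst)

module _ {a p} {A : Set a} {P : Pred A p} (P? : Decidable P) where

  length-filter-∁ : ∀ xs → length (filter P? xs) + length (filter (∁? P?) xs) ≡ length xs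
  length-filter-∁ [] = refl
  length-filter-∁ (x ∷ xs) with P? x
  ... | yes _ = cong suc (length-filter-∁ xs)
  ... | no _  = trans (+-suc _ _) (cong suc (length-filter-∁ xs))

  filter-filter-⊆ : ∀ {q} {Q : Pred A q} (Q? : Decidable Q) → Q ⊆ P →
                    ∀ xs → filter Q? (filter P? xs) ≡ filter Q? xs
  filter-filter-⊆ Q? Q⊆P [] = refl
  filter-filter-⊆ Q? Q⊆P (x ∷ xs) with P? x
  ... | no ¬p = trans (filter-filter-⊆ Q? Q⊆P xs) (sym (filter-reject Q? (¬p ∘ Q⊆P)))
  ... | yes _ with Q? x
  ...   | yes _ = cong (x ∷_) (filter-filter-⊆ Q? Q⊆P xs)
  ...   | no _  = filter-filter-⊆ Q? Q⊆P xs

Unique-∼set⇒length≡ : ∀ {a} {A : Set a} {xs ys : List A} →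
                      Unique xs → Unique ys → xs ∼[ set ] ys → length xs ≡ length ys
Unique-∼set⇒length≡ xs-unique ys-unique xs∼ys =
  ↭-length (∼bag⇒↭ (unique∧set⇒bag xs-unique ys-unique xs∼ys))

module _ {a ℓ} {A : Set a} {_≈_ : Rel A ℓ} (≈-isDecEquivalence : IsDecEquivalence _≈_) where
  open IsDecEquivalence ≈-isDecEquivalence
    using (_≟_) renaming (refl to ≈-refl; sym to ≈-sym; trans to ≈-trans)

  ClassesOfSize : ℕ → List A → Set a
  ClassesOfSize k xs = ∀ {x} → x ∈ xs → length (filter (x ≟_) xs) ≡ k

  -- Split off the class of the head; the remaining classes meet the rest exactly as before.
  ClassesOfSize⇒∣length : ∀ {k} xs → ClassesOfSize k xs → k ∣ length xs
  ClassesOfSize⇒∣length xs = go xs (<-wellFounded (length xs))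
    where
    go : ∀ {k} xs → Acc _<_ (length xs) → ClassesOfSize k xs → k ∣ length xs
    go [] _ _ = _ ∣0
    go {k} xs@(x ∷ _) (acc rec) sizes =
      subst (k ∣_) (length-filter-∁ (x ≟_) xs)
        (∣m∣n⇒∣m+n (subst (k ∣_) (sym (sizes (here refl))) ∣-refl)
                   (go rest (rec shorter) restSizes))
      where
      rest = filter (∁? (x ≟_)) xs

      shorter : length rest < length xs
      shorter = filter-notAll (∁? (x ≟_)) xs (here (λ x≉x → x≉x ≈-refl))

      restSizes : ClassesOfSize k rest
      restSizes {y} y∈rest =
        trans (cong length (filter-filter-⊆ (∁? (x ≟_)) (y ≟_) class-y⊆rest xs)) (sizes y∈xs)
        where
        y∈xs = proj₁ (∈-filter⁻ (∁? (x ≟_)) y∈rest)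
        x≉y  = proj₂ (∈-filter⁻ (∁? (x ≟_)) y∈rest)
        class-y⊆rest : (y ≈_) ⊆ ∁ (x ≈_)
        class-y⊆rest y≈z x≈z = x≉y (≈-trans x≈z (≈-sym y≈z))

data TriangleVertex : Fin 4 → Set where
  t₀ : TriangleVertex zero
  t₁ : TriangleVertex (suc zero)
  t₂ : TriangleVertex (suc (suc zero))

C3+K1-Adj⇒TriangleVertex : ∀ i j → C3+K1-Adj i j → TriangleVertex i
C3+K1-Adj⇒TriangleVertex zero                   _ _ = t₀
C3+K1-Adj⇒TriangleVertex (suc zero)             _ _ = t₁
C3+K1-Adj⇒TriangleVertex (suc (suc zero))       _ _ = t₂
C3+K1-Adj⇒TriangleVertex (suc (suc (suc zero))) zero ()
C3+K1-Adj⇒TriangleVertex (suc (suc (suc zero))) (suc zero) ()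
C3+K1-Adj⇒TriangleVertex (suc (suc (suc zero))) (suc (suc zero)) ()
C3+K1-Adj⇒TriangleVertex (suc (suc (suc zero))) (suc (suc (suc zero))) ()

TriangleVertex⇒C3+K1-Adj : ∀ {i j} → TriangleVertex i → TriangleVertex j → i ≢ j → C3+K1-Adj i j
TriangleVertex⇒C3+K1-Adj t₀ t₀ i≢j = ⊥-elim (i≢j refl)
TriangleVertex⇒C3+K1-Adj t₀ t₁ _   = tt
TriangleVertex⇒C3+K1-Adj t₀ t₂ _   = tt
TriangleVertex⇒C3+K1-Adj t₁ t₀ _   = tt
TriangleVertex⇒C3+K1-Adj t₁ t₁ i≢j = ⊥-elim (i≢j refl)
TriangleVertex⇒C3+K1-Adj t₁ t₂ _   = tt
TriangleVertex⇒C3+K1-Adj t₂ t₀ _   = tt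
TriangleVertex⇒C3+K1-Adj t₂ t₁ _   = tt
TriangleVertex⇒C3+K1-Adj t₂ t₂ i≢j = ⊥-elim (i≢j refl)

TriangleVertex⇒∃C3+K1-Adj : ∀ {i} → TriangleVertex i → ∃ (C3+K1-Adj i)
TriangleVertex⇒∃C3+K1-Adj t₀ = suc zero , tt
TriangleVertex⇒∃C3+K1-Adj t₁ = zero , tt
TriangleVertex⇒∃C3+K1-Adj t₂ = zero , tt

module _ {n} (G : SimpleGraph n) where
  open SimpleGraph G renaming (sym to Adj-sym)

  EdgeInTriangle : Fin n → Fin n → Set
  EdgeInTriangle x y = Adj x y × ∃ λ z → Adj x z × Adj y z

  edgeInTriangle? : ∀ x y → Dec (EdgeInTriangle x y)
  edgeInTriangle? x y = adj? x y ×-dec any? (λ z → adj? x z ×-dec adj? y z)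

  EdgeInTriangle-sym : ∀ {x y} → EdgeInTriangle x y → EdgeInTriangle y x
  EdgeInTriangle-sym (xy , z , xz , yz) = Adj-sym xy , z , yz , xz

  Linked : Fin n → Fin n → Set
  Linked x y = x ≡ y ⊎ EdgeInTriangle x y

  linked? : ∀ x y → Dec (Linked x y)
  linked? x y = (x ≟ᶠ y) ⊎-dec edgeInTriangle? x y

  Linked-sym : ∀ {x y} → Linked x y → Linked y x
  Linked-sym (inj₁ x≡y) = inj₁ (sym x≡y)
  Linked-sym (inj₂ xy)  = inj₂ (EdgeInTriangle-sym xy)

module Neighbourhood {n} {G : SimpleGraph n} {v} (iso : NbhdIsoC3+K1 G v) where
  open SimpleGraph G using (Adj; irrefl)

  f : Fin 4 → Fin n
  f = proj₁ iso

  f-adj : ∀ i → Adj v (f i)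
  f-adj = proj₁ (proj₂ iso)

  f-injective : ∀ i j → f i ≡ f j → i ≡ j
  f-injective = proj₁ (proj₂ (proj₂ iso))

  f-surjective : ∀ w → Adj v w → ∃ λ i → f i ≡ w
  f-surjective = proj₁ (proj₂ (proj₂ (proj₂ iso)))

  f-iso : ∀ i j → Adj (f i) (f j) ⇔ C3+K1-Adj i j
  f-iso = proj₂ (proj₂ (proj₂ (proj₂ iso)))

  EdgeInTriangle⇒TriangleVertex : ∀ {y} → EdgeInTriangle G v y →
                                  ∃ λ i → TriangleVertex i × f i ≡ y
  EdgeInTriangle⇒TriangleVertex (vy , w , vw , yw) with f-surjective _ vy | f-surjective w vw
  ... | i , refl | j , refl = i , C3+K1-Adj⇒TriangleVertex i j (Equivalence.to (f-iso i j) yw) , refl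

  TriangleVertex⇒EdgeInTriangle : ∀ {i} → TriangleVertex i → EdgeInTriangle G v (f i)
  TriangleVertex⇒EdgeInTriangle {i} t with TriangleVertex⇒∃C3+K1-Adj t
  ... | j , ij = f-adj i , f j , f-adj j , Equivalence.from (f-iso i j) ij

  EdgeInTriangle⇒Adj : ∀ {x y} → EdgeInTriangle G v x → EdgeInTriangle G v y → x ≢ y → Adj x y
  EdgeInTriangle⇒Adj vx vy x≢y
    with EdgeInTriangle⇒TriangleVertex vx | EdgeInTriangle⇒TriangleVertex vy
  ... | i , tᵢ , refl | j , tⱼ , refl =
    Equivalence.from (f-iso i j) (TriangleVertex⇒C3+K1-Adj tᵢ tⱼ (x≢y ∘ cong f))

  clique : List (Fin n)
  clique = v ∷ f zero ∷ f (suc zero) ∷ f (suc (suc zero)) ∷ []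

  ∈-clique⇔Linked : ∀ {y} → y ∈ clique ⇔ Linked G v y
  ∈-clique⇔Linked = mk⇔ to from
    where
    to : ∀ {y} → y ∈ clique → Linked G v y
    to (here refl)                         = inj₁ refl
    to (there (here refl))                 = inj₂ (TriangleVertex⇒EdgeInTriangle t₀)
    to (there (there (here refl)))         = inj₂ (TriangleVertex⇒EdgeInTriangle t₁)
    to (there (there (there (here refl)))) = inj₂ (TriangleVertex⇒EdgeInTriangle t₂)

    from : ∀ {y} → Linked G v y → y ∈ clique
    from (inj₁ refl) = here refl
    from (inj₂ vy) with EdgeInTriangle⇒TriangleVertex vy
    ... | _ , t₀ , refl = there (here refl)
    ... | _ , t₁ , refl = there (there (here refl))
    ... | _ , t₂ , refl = there (there (there (here refl)))

  clique-unique : Unique clique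
  clique-unique = (v≢f zero ∷ v≢f (suc zero) ∷ v≢f (suc (suc zero)) ∷ [])
                ∷ (f-≢ (λ ()) ∷ f-≢ (λ ()) ∷ [])
                ∷ (f-≢ (λ ()) ∷ [])
                ∷ []
                ∷ []
    where
    v≢f : ∀ i → v ≢ f i
    v≢f i v≡fi = irrefl (subst (Adj v) (sym v≡fi) (f-adj i))

    f-≢ : ∀ {i j} → i ≢ j → f i ≢ f j
    f-≢ i≢j = i≢j ∘ f-injective _ _

module _ {n} (G : SimpleGraph n) (locallyC3+K1 : ∀ v → NbhdIsoC3+K1 G v) where
  open SimpleGraph G using (Adj) renaming (sym to Adj-sym)
  module Local (v : Fin n) = Neighbourhood {G = G} {v = v} (locallyC3+K1 v)

  -- y itself is the third vertex of a triangle on x and z.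
  Linked-trans : ∀ {x y z} → Linked G x y → Linked G y z → Linked G x z
  Linked-trans (inj₁ refl) yz = yz
  Linked-trans xy (inj₁ refl) = xy
  Linked-trans {x} {y} {z} (inj₂ xy) (inj₂ yz) with x ≟ᶠ z
  ... | yes x≡z = inj₁ x≡z
  ... | no x≢z  = inj₂ (Local.EdgeInTriangle⇒Adj y (EdgeInTriangle-sym G xy) yz x≢z
                       , y , proj₁ xy , Adj-sym (proj₁ yz))

  Linked-isDecEquivalence : IsDecEquivalence (Linked G)
  Linked-isDecEquivalence = record
    { isEquivalence = record { refl = inj₁ refl ; sym = Linked-sym G ; trans = Linked-trans }
    ; _≟_ = linked? G
    }

  allFin-classesOfSize4 : ClassesOfSize Linked-isDecEquivalence 4 (allFin n)
  allFin-classesOfSize4 {x} _ = Unique-∼set⇒length≡ class-unique clique-unique class∼clique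
    where
    open Local x using (clique; clique-unique; ∈-clique⇔Linked)

    class : List (Fin n)
    class = filter (linked? G x) (allFin n)

    class-unique : Unique class
    class-unique = filter⁺ (linked? G x) (allFin⁺ n)

    class∼clique : class ∼[ set ] clique
    class∼clique {y} = mk⇔
      (Equivalence.from ∈-clique⇔Linked ∘ proj₂ ∘ ∈-filter⁻ (linked? G x) {xs = allFin n})
      (∈-filter⁺ (linked? G x) (∈-allFin y) ∘ Equivalence.to ∈-clique⇔Linked)

lemma1 : (n : ℕ) (G : SimpleGraph n) →
    (∀ v → NbhdIsoC3+K1 G v) → n % 4 ≡ 0
lemma1 n G locallyC3+K1 = n∣m⇒m%n≡0 n 4 (subst (4 ∣_) (length-tabulate id) 4∣length)
  where
  4∣length : 4 ∣ length (allFin n)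
  4∣length = ClassesOfSize⇒∣length (Linked-isDecEquivalence G locallyC3+K1) (allFin n)
                                   (allFin-classesOfSize4 G locallyC3+K1)
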